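{- The group $S_3\wr S_2$, acting on $\{1,2,3\}\times\{1,2\}$ by $((g_1,g_2),h)\colon(a,i)\mapsto(g_i(a),h(i))$, does not have the strict-EKR-property.
   Context: For a permutation group $K$ on $X$, a subset $I\subseteq K$ is intersecting if for all $g,h\in I$ there is $x\in X$ with $g(x)=h(x)$; $K$ has the strict-EKR-property if every maximum-size intersecting set is a coset of a point stabilizer. -}

module Defs where

open import Data.Bool using (Bool; T)
open import Data.Nat using (ℕ; _≤_)
open import Data.Fin using (Fin; zero; suc)
open import Data.Product using (_×_; _,_; ∃; Σ)
open import Data.List using (List; length; filter; allFin; cartesianProduct; map)
open import Data.Vec using (Vec; _∷_; []; lookup)
open import Function.Bundles using (_⇔_)
open import Relation.Binary.PropositionalEquality using (_≡_)
open import Relation.Nullary.Decidable using (T?)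

-- The point set X = {1,2,3} × {1,2}, written 0-indexed as Fin 3 × Fin 2.
X : Set
X = Fin 3 × Fin 2

-- The six elements of S₃, listed explicitly as the images (σ 0, σ 1, σ 2).
S3table : Vec (Vec (Fin 3) 3) 6
S3table =
    (zero ∷ suc zero ∷ suc (suc zero) ∷ [])
  ∷ (suc zero ∷ zero ∷ suc (suc zero) ∷ [])
  ∷ (suc (suc zero) ∷ suc zero ∷ zero ∷ [])
  ∷ (zero ∷ suc (suc zero) ∷ suc zero ∷ [])
  ∷ (suc zero ∷ suc (suc zero) ∷ zero ∷ [])
  ∷ (suc (suc zero) ∷ zero ∷ suc zero ∷ [])
  ∷ []

S3 : Set
S3 = Fin 6

perm3 : S3 → Fin 3 → Fin 3
perm3 σ a = lookup (lookup S3table σ) a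

S2table : Vec (Vec (Fin 2) 2) 2
S2table =
    (zero ∷ suc zero ∷ [])
  ∷ (suc zero ∷ zero ∷ [])
  ∷ []

S2 : Set
S2 = Fin 2

perm2 : S2 → Fin 2 → Fin 2
perm2 τ i = lookup (lookup S2table τ) i

W : Set
W = (S3 × S3) × S2

act : W → X → X
act ((g₁ , g₂) , h) (a , i) = perm3 (lookup (g₁ ∷ g₂ ∷ []) i) a , perm2 h i

allW : List W
allW = cartesianProduct (cartesianProduct (allFin 6) (allFin 6)) (allFin 2)

Subset : Set
Subset = W → Bool

_∈ˢ_ : W → Subset → Set
g ∈ˢ S = T (S g)

size : Subset → ℕ
size S = length (filter (λ g → T? (S g)) allW)

Intersecting : Subset → Set
Intersecting I = ∀ g h → g ∈ˢ I → h ∈ˢ I → ∃ λ (x : X) → act g x ≡ act h x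

MaxIntersecting : Subset → Set
MaxIntersecting I = Intersecting I × (∀ J → Intersecting J → size J ≤ size I)

-- I is a (left) coset g K_x of the stabiliser K_x of a point x:
-- k ∈ I  iff  k = g s for some s ∈ K with s(x) = x (equality of permutations of X).
IsCosetOfPointStabilizer : Subset → Set
IsCosetOfPointStabilizer I =
  Σ W λ g → Σ X λ x → ∀ k →
    (k ∈ˢ I) ⇔ (∃ λ s → (act s x ≡ x) × (∀ y → act k y ≡ act g (act s y)))

StrictEKR : Set
StrictEKR = ∀ I → MaxIntersecting I → IsCosetOfPointStabilizer I

-- The 72 elements of S₃ ≀ S₂ split into 12 classes of six elements, no two of which agree
-- at any point (a clique partition of the derangement graph). An intersecting set meets
-- each class at most once, so it has at most 12 = 72 / 6 elements, the size of a point
-- stabiliser. The 12-element subset `counterexample` of the base group S₃ × S₃ is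
-- intersecting, hence of maximum size, yet for every point x two of its members move x
-- to different points, while all members of a coset g K_x send x to g x.
module Submission where

open import Defs
open import Relation.Nullary using (¬_)
open import Data.Bool using (true; false)
open import Data.Nat using (_≤_)
open import Data.Fin using (Fin; zero; suc; #_)
open import Data.Fin.Properties using (any?; injective⇒≤) renaming (_≟_ to _≟ᶠ_)
open import Data.Product using (_×_; _,_; ∃; ∃₂)
open import Data.Product.Properties using (≡-dec)
open import Data.List using (List; _∷_; length; filter; lookup)
import Data.List.Relation.Unary.All as All
open import Data.List.Relation.Unary.AllPairs using (_∷_)
open import Data.List.Relation.Unary.Unique.Propositional using (Unique)
open import Data.List.Relation.Unary.Unique.Propositional.Properties
  using (cartesianProduct⁺; allFin⁺; filter⁺)
open import Data.List.Membership.Propositional using (_∈_)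
open import Data.List.Membership.Propositional.Properties using (∈-lookup; ∈-filter⁻)
open import Data.Vec using (_∷_; [])
import Data.Vec as Vec
open import Function using (_∘_)
open import Function.Bundles using (Equivalence)
open import Relation.Binary.PropositionalEquality using (_≡_; _≢_; refl; sym; trans; cong)
open import Relation.Nullary.Decidable
  using (Dec; map′; from-yes; decidable-stable; ¬?; _→-dec_; _×-dec_; T?)
open import Relation.Nullary.Negation using (contradiction)
open import Relation.Unary using (Decidable)

private
  variable
    A B : Set

Searchable : Set → Set₁
Searchable A = ∀ {P : A → Set} → Decidable P → Dec (∃ P)

fin-searchable : ∀ {n} → Searchable (Fin n)
fin-searchable = any?

×-searchable : Searchable A → Searchable B → Searchable (A × B)
×-searchable searchA searchB P? =
  map′ (λ (a , b , p) → (a , b) , p) (λ ((a , b) , p) → a , b , p)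
       (searchA λ a → searchB λ b → P? (a , b))

searchable⇒∀? : Searchable A → ∀ {P : A → Set} → Decidable P → Dec (∀ a → P a)
searchable⇒∀? search P? =
  map′ (λ ∄counterexample a → decidable-stable (P? a) (λ ¬Pa → ∄counterexample (a , ¬Pa)))
       (λ ∀P (a , ¬Pa) → ¬Pa (∀P a))
       (¬? (search (¬? ∘ P?)))

X-searchable : Searchable X
X-searchable = ×-searchable fin-searchable fin-searchable

W-searchable : Searchable W
W-searchable = ×-searchable (×-searchable fin-searchable fin-searchable) fin-searchable

_≟X_ : (x y : X) → Dec (x ≡ y)
_≟X_ = ≡-dec _≟ᶠ_ _≟ᶠ_

_≟W_ : (g h : W) → Dec (g ≡ h)
_≟W_ = ≡-dec (≡-dec _≟ᶠ_ _≟ᶠ_) _≟ᶠ_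

lookup-injective : {xs : List A} → Unique xs → ∀ i j → lookup xs i ≡ lookup xs j → i ≡ j
lookup-injective (_   ∷ _)  zero    zero    _  = refl
lookup-injective (x∉ ∷ _)  zero    (suc j) eq = contradiction eq (All.lookup x∉ (∈-lookup j))
lookup-injective (x∉ ∷ _)  (suc i) zero    eq = contradiction (sym eq) (All.lookup x∉ (∈-lookup i))
lookup-injective (_   ∷ u) (suc i) (suc j) eq = cong suc (lookup-injective u i j eq)

injectiveOn⇒length≤ : ∀ {n} (f : A → Fin n) {xs : List A} → Unique xs →
                       (∀ {x y} → x ∈ xs → y ∈ xs → f x ≡ f y → x ≡ y) →
                       length xs ≤ n
injectiveOn⇒length≤ f unique injOn =
  injective⇒≤ λ {i} {j} eq → lookup-injective unique i j (injOn (∈-lookup i) (∈-lookup j) eq)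

allW-unique : Unique allW
allW-unique = cartesianProduct⁺ (cartesianProduct⁺ (allFin⁺ 6) (allFin⁺ 6)) (allFin⁺ 2)

Agree : W → W → Set
Agree g h = ∃ λ (x : X) → act g x ≡ act h x

agree? : ∀ g h → Dec (Agree g h)
agree? g h = X-searchable λ x → act g x ≟X act h x

CliquePartition : ∀ {n} → (W → Fin n) → Set
CliquePartition cl = ∀ g h → cl g ≡ cl h → Agree g h → g ≡ h

intersecting⇒size≤ : ∀ {n} (cl : W → Fin n) → CliquePartition cl →
                     ∀ J → Intersecting J → size J ≤ n
intersecting⇒size≤ cl partition J intersecting =
  injectiveOn⇒length≤ cl (filter⁺ J? allW-unique) λ g∈ h∈ same →
    partition _ _ same (intersecting _ _ (member g∈) (member h∈))
  where
  J? = λ g → T? (J g)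
  member : ∀ {g} → g ∈ filter J? allW → g ∈ˢ J
  member g∈ with _ , g∈J ← ∈-filter⁻ J? g∈ = g∈J

SeparatesEveryPoint : Subset → Set
SeparatesEveryPoint I =
  ∀ x → ∃₂ λ k₁ k₂ → k₁ ∈ˢ I × k₂ ∈ˢ I × act k₁ x ≢ act k₂ x

separating⇒¬coset : ∀ I → SeparatesEveryPoint I → ¬ IsCosetOfPointStabilizer I
separating⇒¬coset I separates (g , x , coset) with separates x
... | k₁ , k₂ , k₁∈I , k₂∈I , differ = differ (trans (sendsToGx k₁∈I) (sym (sendsToGx k₂∈I)))
  where
  sendsToGx : ∀ {k} → k ∈ˢ I → act k x ≡ act g x
  sendsToGx {k} k∈I with s , sx≡x , k≡gs ← Equivalence.to (coset k) k∈I =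
    trans (k≡gs x) (cong (act g) sx≡x)

cliqueTable : Vec.Vec (Vec.Vec (Vec.Vec (Fin 12) 2) 6) 6
cliqueTable =
    ((# 0 ∷ # 1 ∷ []) ∷ (# 2 ∷ # 3 ∷ []) ∷ (# 4 ∷ # 5 ∷ []) ∷ (# 6 ∷ # 7 ∷ []) ∷ (# 1 ∷ # 0 ∷ []) ∷ (# 8 ∷ # 8 ∷ []) ∷ [])
  ∷ ((# 7 ∷ # 6 ∷ []) ∷ (# 9 ∷ # 10 ∷ []) ∷ (# 11 ∷ # 11 ∷ []) ∷ (# 10 ∷ # 9 ∷ []) ∷ (# 3 ∷ # 2 ∷ []) ∷ (# 5 ∷ # 4 ∷ []) ∷ [])
  ∷ ((# 3 ∷ # 2 ∷ []) ∷ (# 10 ∷ # 9 ∷ []) ∷ (# 9 ∷ # 10 ∷ []) ∷ (# 11 ∷ # 11 ∷ []) ∷ (# 5 ∷ # 4 ∷ []) ∷ (# 7 ∷ # 6 ∷ []) ∷ [])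
  ∷ ((# 5 ∷ # 4 ∷ []) ∷ (# 11 ∷ # 11 ∷ []) ∷ (# 10 ∷ # 9 ∷ []) ∷ (# 9 ∷ # 10 ∷ []) ∷ (# 7 ∷ # 6 ∷ []) ∷ (# 3 ∷ # 2 ∷ []) ∷ [])
  ∷ ((# 8 ∷ # 8 ∷ []) ∷ (# 4 ∷ # 5 ∷ []) ∷ (# 6 ∷ # 7 ∷ []) ∷ (# 2 ∷ # 3 ∷ []) ∷ (# 0 ∷ # 1 ∷ []) ∷ (# 1 ∷ # 0 ∷ []) ∷ [])
  ∷ ((# 1 ∷ # 0 ∷ []) ∷ (# 6 ∷ # 7 ∷ []) ∷ (# 2 ∷ # 3 ∷ []) ∷ (# 4 ∷ # 5 ∷ []) ∷ (# 8 ∷ # 8 ∷ []) ∷ (# 0 ∷ # 1 ∷ []) ∷ [])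
  ∷ []

clique : W → Fin 12
clique ((g₁ , g₂) , h) = Vec.lookup (Vec.lookup (Vec.lookup cliqueTable g₁) g₂) h

clique-partition : CliquePartition clique
clique-partition = from-yes
  (∀W? λ g → ∀W? λ h → (clique g ≟ᶠ clique h) →-dec (agree? g h →-dec (g ≟W h)))
  where ∀W? = searchable⇒∀? W-searchable

pattern id₃  = zero
pattern t₀₁  = suc zero
pattern t₀₂  = suc (suc zero)
pattern t₁₂  = suc (suc (suc zero))
pattern id₂  = zero

counterexample : Subset
counterexample ((id₃ , _)   , id₂) = true
counterexample ((t₀₁ , id₃) , id₂) = true
counterexample ((t₀₁ , t₀₁) , id₂) = true
counterexample ((t₀₁ , t₀₂) , id₂) = true
counterexample ((t₀₁ , t₁₂) , id₂) = true
counterexample ((t₀₂ , id₃) , id₂) = true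
counterexample ((t₁₂ , id₃) , id₂) = true
counterexample _                   = false

counterexample-intersecting : Intersecting counterexample
counterexample-intersecting = from-yes
  (∀W? λ g → ∀W? λ h → T? (counterexample g) →-dec (T? (counterexample h) →-dec agree? g h))
  where ∀W? = searchable⇒∀? W-searchable

counterexample-separates : SeparatesEveryPoint counterexample
counterexample-separates = from-yes
  (searchable⇒∀? X-searchable λ x → W-searchable λ k₁ → W-searchable λ k₂ →
     T? (counterexample k₁) ×-dec T? (counterexample k₂) ×-dec ¬? (act k₁ x ≟X act k₂ x))

-- `size counterexample` evaluates to 12, the bound given by the clique partition.
counterexample-max : MaxIntersecting counterexample
counterexample-max = counterexample-intersecting , intersecting⇒size≤ clique clique-partition

corollary4p9 : ¬ StrictEKR
corollary4p9 strict = separating⇒¬coset counterexample counterexample-separates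
  (strict counterexample counterexample-max)
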